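{- For $n\ge0$ let $a_n$ be the number of permutations $\pi$ of $\{1,\dots,n\}$ with $\#132(\pi)=0$ and $\#123(\pi)=5$. Then $$\sum_{n\ge0}a_nz^n=\frac{z^5(z-1)(z^5-3z^4+19z^3-25z^2+12z-2)}{(1-2z)^6}.$$
   Context: For a permutation $\pi=\pi_1\cdots\pi_n$, $\#123(\pi)$ is the number of triples $i_1<i_2<i_3$ with $\pi_{i_1}<\pi_{i_2}<\pi_{i_3}$, and $\#132(\pi)$ is the number of triples $i_1<i_2<i_3$ with $\pi_{i_1}<\pi_{i_3}<\pi_{i_2}$. -}

module Defs where

open import Data.Nat using (ℕ; zero; suc; _<ᵇ_; _≡ᵇ_)
open import Data.Bool using (Bool; true; false; _∧_; not; if_then_else_)
open import Data.List using (List; []; _∷_; map; concatMap; filter; length; upTo; _++_)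
open import Data.Bool.ListAction using (any)
open import Data.Integer using (ℤ; +_; _+_; _*_; -_)
import Data.Integer as ℤ

-- Permutations of {1,…,n}, written in one-line notation π₁ ⋯ πₙ as lists.

words : ℕ → ℕ → List (List ℕ)
words n zero    = [] ∷ []
words n (suc k) = concatMap (λ x → map (x ∷_) (words n k)) (map suc (upTo n))

distinct : List ℕ → Bool
distinct []       = true
distinct (x ∷ xs) = not (any (λ y → x ≡ᵇ y) xs) ∧ distinct xs

perms : ℕ → List (List ℕ)
perms n = filter (λ w → distinct w Data.Bool.≟ true) (words n n)

choose : ℕ → List ℕ → List (List ℕ)
choose zero    _        = [] ∷ []
choose (suc k) []       = []
choose (suc k) (x ∷ xs) = map (x ∷_) (choose k xs) ++ choose (suc k) xs

is123 : List ℕ → Bool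
is123 (a ∷ b ∷ c ∷ []) = (a <ᵇ b) ∧ (b <ᵇ c)
is123 _                = false

is132 : List ℕ → Bool
is132 (a ∷ b ∷ c ∷ []) = (a <ᵇ c) ∧ (c <ᵇ b)
is132 _                = false

#123 : List ℕ → ℕ
#123 π = length (filter (λ t → is123 t Data.Bool.≟ true) (choose 3 π))

#132 : List ℕ → ℕ
#132 π = length (filter (λ t → is132 t Data.Bool.≟ true) (choose 3 π))

a : ℕ → ℕ
a n = length (filter (λ π → ((#132 π ≡ᵇ 0) ∧ (#123 π ≡ᵇ 5)) Data.Bool.≟ true) (perms n))

-- Polynomials over ℤ as coefficient lists (constant term first),
-- formal power series as ℕ → ℤ.

Poly : Set
Poly = List ℤ

_⊕_ : Poly → Poly → Poly
[]       ⊕ q        = q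
p        ⊕ []       = p
(x ∷ p)  ⊕ (y ∷ q)  = (x + y) ∷ (p ⊕ q)

scale : ℤ → Poly → Poly
scale c = map (c *_)

_⊗_ : Poly → Poly → Poly
[]      ⊗ q = []
(x ∷ p) ⊗ q = scale x q ⊕ (+ 0 ∷ (p ⊗ q))

_^ᵖ_ : Poly → ℕ → Poly
p ^ᵖ zero  = + 1 ∷ []
p ^ᵖ suc k = p ⊗ (p ^ᵖ k)

coeff : Poly → ℕ → ℤ
coeff []       n       = + 0
coeff (x ∷ p)  zero    = x
coeff (x ∷ p)  (suc n) = coeff p n

-- coefficient of z^n in the product P(z)·F(z), P polynomial, F power series
-- = Σ_{k=0}^{n} P_k F_{n-k}
mulCoeff : Poly → (ℕ → ℤ) → ℕ → ℤ
mulCoeff []      F n       = + 0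
mulCoeff (x ∷ p) F zero    = x * F zero
mulCoeff (x ∷ p) F (suc n) = x * F (suc n) + mulCoeff p F n

z : Poly
z = + 0 ∷ + 1 ∷ []

numer : Poly
numer = (z ^ᵖ 5) ⊗ ((ℤ.- (+ 1) ∷ + 1 ∷ [])
          ⊗ (ℤ.- (+ 2) ∷ + 12 ∷ ℤ.- (+ 25) ∷ + 19 ∷ ℤ.- (+ 3) ∷ + 1 ∷ []))

denom : Poly
denom = (+ 1 ∷ ℤ.- (+ 2) ∷ []) ^ᵖ 6

-- Split a permutation after its first letter x.  In a 132-avoiding word the letters larger than x that
-- follow x must increase, so x starts exactly j C 2 occurrences of 123, j being their number.  Recording
-- how many of the remaining letters are still forced to increase turns the count into a recursion N k h r
-- in the length k, that number h and the number r of occurrences of 123 still to be produced.  For r ≤ 5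
-- only h < 4 is relevant (4 C 2 = 6), so N (k + 1) arises from N k by one linear operator on 24 states.
-- Multiplying the generating function by (1 - 2z)^6 yields coefficients that this operator propagates
-- from degree 6 on; they vanish on every state in degree 13, hence in every higher degree, and the
-- coefficients below degree 13 are checked by evaluation.

module Submission where

open import Defs
open import Data.Bool.ListAction using (any)
open import Data.Nat using (ℕ; zero; suc; _+_; _∸_; _≤_; _<_; _≤ᵇ_; _<ᵇ_; _≡ᵇ_; z≤n; s≤s; _⊔_)
open import Data.Nat.Properties
  using ( _≟_; _<?_; _≤?_; ≤-refl; ≤-reflexive; ≤-trans; ≤-antisym; <⇒≤; <-irrefl; <-trans; ≤-<-trans
        ; ≤∧≢⇒<; ≮⇒≥; <⇒≱; +-suc; +-comm; +-assoc; +-identityʳ; +-mono-≤; +-cancelʳ-≤; +-monoʳ-≤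
        ; m∸n≤m; m≤m+n; m≤n+m; m+n≡0⇒m≡0; m+n≡0⇒n≡0; m+n∸m≡n; m+[n∸m]≡n; m≤n⇒m<n∨m≡n; m≤n⇒m≤1+n
        ; n≤1+n; ≤-pred; n≤0⇒n≡0; m≤m⊔n; m≤n⊔m; suc-injective; <ᵇ⇒<; <⇒<ᵇ; ≡ᵇ⇒≡; ≡⇒≡ᵇ
        ; module ≤-Reasoning )
open import Data.Bool using (Bool; true; false; _∧_; not; if_then_else_; T) renaming (_≟_ to _≟ᵇ_)
open import Data.Bool.Properties using (T-≡; if-float; if-eta; ∧-zeroʳ)
open import Data.List using (List; []; _∷_; [_]; _++_; map; concatMap; filter; length; upTo; applyUpTo)
open import Data.List.Properties
  using ( length-filter; filter-accept; filter-reject; filter-++; length-++; filter-none; filter-all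
        ; map-++; map-cong-local; length-map; length-upTo; upTo-∷ʳ )
open import Data.Nat.ListAction using (sum)
open import Data.Nat.ListAction.Properties using (sum-++)
open import Data.List.Relation.Unary.All as All using (All; []; _∷_)
open import Data.List.Relation.Unary.All.Properties using (concat⁺; map⁺)
open import Data.List.Relation.Unary.AllPairs using ([]; _∷_)
open import Data.List.Relation.Unary.Any using (here; there)
open import Data.List.Relation.Unary.Unique.Propositional using (Unique)
import Data.List.Relation.Unary.Unique.Propositional.Properties as Unique
open import Data.List.Relation.Unary.Unique.DecPropositional _≟_ using (unique?)
open import Data.List.Membership.Propositional using (_∈_; _∉_)
open import Data.List.Membership.Propositional.Properties using (∈-filter⁺; ∈-filter⁻; ∈-map⁻; ∈-upTo⁻)
open import Data.List.Membership.DecPropositional _≟_ using (_∉?_)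
open import Data.Integer using (ℤ; +_) renaming (_+_ to _+ℤ_; _*_ to _*ℤ_)
import Data.Integer.Properties as ℤ
open import Data.Nat.Combinatorics using (_C_; nC1≡n; nCk+nC[k+1]≡[n+1]C[k+1])
open import Data.Product using (_×_; _,_; proj₁; proj₂)
open import Data.Unit using (tt)
open import Data.Sum using (inj₁; inj₂)
open import Function using (_∘_; _⇔_; mk⇔; Equivalence)
open import Relation.Nullary using (Dec; yes; no; does; ¬_; ¬?; _×-dec_; contradiction)
open import Relation.Nullary.Decidable using (dec-true; dec-false)
open import Relation.Unary using (Decidable)
open import Relation.Binary using (DecidableEquality)
open import Relation.Binary.PropositionalEquality
  using (_≡_; _≢_; refl; sym; trans; cong; cong₂; subst; module ≡-Reasoning)

open Equivalence using (to; from)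

count : {A : Set} {P : A → Set} → Decidable P → List A → ℕ
count P? xs = length (filter P? xs)

module _ {A : Set} where

  module _ {P : A → Set} (P? : Decidable P) where

    count-++ : ∀ xs ys → count P? (xs ++ ys) ≡ count P? xs + count P? ys
    count-++ xs ys = trans (cong length (filter-++ P? xs ys)) (length-++ (filter P? xs))

    count-map : ∀ {B : Set} (f : B → A) xs → count P? (map f xs) ≡ count (λ b → P? (f b)) xs
    count-map f [] = refl
    count-map f (x ∷ xs) with P? (f x)
    ... | yes _ = cong suc (count-map f xs)
    ... | no  _ = count-map f xs

    count-concatMap : ∀ {B : Set} (f : B → List A) xs → count P? (concatMap f xs) ≡ sum (map (count P? ∘ f) xs)
    count-concatMap f []       = refl
    count-concatMap f (x ∷ xs) =
      trans (count-++ (f x) (concatMap f xs)) (cong (_+_ (count P? (f x))) (count-concatMap f xs))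

    count≡0⇒All¬ : ∀ {xs} → count P? xs ≡ 0 → All (¬_ ∘ P) xs
    count≡0⇒All¬ {[]}     _ = []
    count≡0⇒All¬ {x ∷ xs} c with P? x
    ... | no ¬p = ¬p ∷ count≡0⇒All¬ c

    All¬⇒count≡0 : ∀ {xs} → All (¬_ ∘ P) xs → count P? xs ≡ 0
    All¬⇒count≡0 ¬ps = cong length (filter-none P? ¬ps)

    count-accept : ∀ {x} xs → P x → count P? (x ∷ xs) ≡ suc (count P? xs)
    count-accept xs p = cong length (filter-accept P? p)

    count-reject : ∀ {x} xs → ¬ P x → count P? (x ∷ xs) ≡ count P? xs
    count-reject xs ¬p = cong length (filter-reject P? ¬p)

    module _ {Q : A → Set} (Q? : Decidable Q) where

      count-mono : ∀ {xs} → All (λ x → P x → Q x) xs → count P? xs ≤ count Q? xs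
      count-mono {[]}     []         = z≤n
      count-mono {x ∷ xs} (p⇒q ∷ ps) with P? x | Q? x
      ... | yes p | yes _ = s≤s (count-mono ps)
      ... | yes p | no ¬q = contradiction (p⇒q p) ¬q
      ... | no _  | yes _ = m≤n⇒m≤1+n (count-mono ps)
      ... | no _  | no _  = count-mono ps

      count-split : ∀ xs →
        count P? xs ≡ count (λ x → P? x ×-dec Q? x) xs + count (λ x → P? x ×-dec ¬? (Q? x)) xs
      count-split []       = refl
      count-split (x ∷ xs) with P? x | Q? x
      ... | yes _ | yes _ = cong suc (count-split xs)
      ... | yes _ | no _  = trans (cong suc (count-split xs)) (sym (+-suc _ _))
      ... | no _  | _     = count-split xs

      count-filter : ∀ xs → count Q? (filter P? xs) ≡ count (λ x → P? x ×-dec Q? x) xs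
      count-filter []       = refl
      count-filter (x ∷ xs) with P? x
      ... | no _ = count-filter xs
      ... | yes _ with Q? x
      ...   | yes _ = cong suc (count-filter xs)
      ...   | no _  = count-filter xs

  module _ {P Q : A → Set} {P? : Decidable P} {Q? : Decidable Q} where

    count-cong : ∀ {xs} → All (λ x → P x ⇔ Q x) xs → count P? xs ≡ count Q? xs
    count-cong eqs = ≤-antisym (count-mono P? Q? (All.map to eqs)) (count-mono Q? P? (All.map from eqs))

  length≡count+count : {Q : A → Set} (Q? : Decidable Q) → ∀ xs → length xs ≡ count Q? xs + count (¬? ∘ Q?) xs
  length≡count+count Q? []       = refl
  length≡count+count Q? (x ∷ xs) with Q? x
  ... | yes _ = cong suc (length≡count+count Q? xs)
  ... | no _  = trans (cong suc (length≡count+count Q? xs)) (sym (+-suc _ _))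

  count-guard : {D : Set} {Q : A → Set} (D? : Dec D) (Q? : Decidable Q) → ∀ xs →
                count (λ x → D? ×-dec Q? x) xs ≡ (if does D? then count Q? xs else 0)
  count-guard (yes d) Q? xs = count-cong (All.universal (λ _ → mk⇔ proj₂ (d ,_)) xs)
  count-guard (no ¬d) Q? xs = All¬⇒count≡0 _ (All.universal (λ _ → ¬d ∘ proj₁) xs)

module _ {A : Set} (_≟ᴬ_ : DecidableEquality A) where

  unique⇒count≡1 : ∀ {x xs} → Unique xs → x ∈ xs → count (_≟ᴬ x) xs ≡ 1
  unique⇒count≡1 {x} (x≢xs ∷ _) (here refl) with x ≟ᴬ x
  ... | yes _   = cong suc (All¬⇒count≡0 _ (All.map (λ x≢y y≡x → x≢y (sym y≡x)) x≢xs))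
  ... | no x≢x = contradiction refl x≢x
  unique⇒count≡1 {x} {y ∷ _} (y≢ys ∷ u) (there x∈ys) with y ≟ᴬ x
  ... | yes refl = contradiction refl (All.lookup y≢ys x∈ys)
  ... | no _     = unique⇒count≡1 u x∈ys

  unique-length-≤ : ∀ {xs ys} → Unique xs → Unique ys → All (_∈ ys) xs → length xs ≤ length ys
  unique-length-≤ {[]}              _              _   _                 = z≤n
  unique-length-≤ {x ∷ xs} {ys} (x≢xs ∷ uxs) uys (x∈ys ∷ xs⊆ys) = begin
    suc (length xs)                 ≤⟨ s≤s (unique-length-≤ uxs (Unique.filter⁺ ≢x? uys) xs⊆ys∖x) ⟩
    suc (count ≢x? ys)              ≡⟨ cong (_+ count ≢x? ys) (unique⇒count≡1 uys x∈ys) ⟨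
    count (_≟ᴬ x) ys + count ≢x? ys ≡⟨ length≡count+count (_≟ᴬ x) ys ⟨
    length ys                       ∎
    where
    open ≤-Reasoning
    ≢x? = λ y → ¬? (y ≟ᴬ x)
    xs⊆ys∖x : All (_∈ filter ≢x? ys) xs
    xs⊆ys∖x = All.zipWith (λ (x≢y , y∈ys) → ∈-filter⁺ ≢x? y∈ys (λ y≡x → x≢y (sym y≡x)))
                          (x≢xs , xs⊆ys)

  count-enumeration : ∀ {xs ys} → Unique xs → Unique ys → All (_∈ ys) xs → length xs ≡ length ys →
                      ∀ {P : A → Set} (P? : Decidable P) → count P? xs ≡ count P? ys
  count-enumeration {xs} {ys} uxs uys xs⊆ys |xs|≡|ys| P? =
    squeeze (filtered-≤ P?) (filtered-≤ (¬? ∘ P?))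
            (trans (sym (length≡count+count P? xs)) (trans |xs|≡|ys| (length≡count+count P? ys)))
    where
    filtered-≤ : ∀ {Q : A → Set} (Q? : Decidable Q) → count Q? xs ≤ count Q? ys
    filtered-≤ Q? = unique-length-≤ (Unique.filter⁺ Q? uxs) (Unique.filter⁺ Q? uys)
      (All.tabulate λ z∈ → let (z∈xs , qz) = ∈-filter⁻ Q? z∈ in ∈-filter⁺ Q? (All.lookup xs⊆ys z∈xs) qz)
    squeeze : ∀ {a b c d} → a ≤ c → b ≤ d → a + b ≡ c + d → a ≡ c
    squeeze {a} {b} {c} {d} a≤c b≤d eq =
      ≤-antisym a≤c (+-cancelʳ-≤ b c a (≤-trans (+-monoʳ-≤ c b≤d) (≤-reflexive (sym eq))))

∑< : ℕ → (ℕ → ℕ) → ℕ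
∑< zero    f = 0
∑< (suc m) f = ∑< m f + f m

syntax ∑< m (λ j → e) = ∑[ j < m ] e

∑-cong : ∀ m {f g : ℕ → ℕ} → (∀ j → j < m → f j ≡ g j) → ∑< m f ≡ ∑< m g
∑-cong zero    _  = refl
∑-cong (suc m) eq = cong₂ _+_ (∑-cong m (λ j j<m → eq j (m≤n⇒m≤1+n j<m))) (eq m ≤-refl)

∑-shift : ∀ m (f : ℕ → ℕ) → ∑[ j < m ] f (suc j) + f 0 ≡ ∑[ j < suc m ] f j
∑-shift zero    f = refl
∑-shift (suc m) f = begin
  ∑[ j < m ] f (suc j) + f (suc m) + f 0   ≡⟨ +-assoc (∑[ j < m ] f (suc j)) _ _ ⟩
  ∑[ j < m ] f (suc j) + (f (suc m) + f 0) ≡⟨ cong (_+_ (∑[ j < m ] f (suc j))) (+-comm (f (suc m)) (f 0)) ⟩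
  ∑[ j < m ] f (suc j) + (f 0 + f (suc m)) ≡⟨ +-assoc (∑[ j < m ] f (suc j)) _ _ ⟨
  ∑[ j < m ] f (suc j) + f 0 + f (suc m)   ≡⟨ cong (_+ f (suc m)) (∑-shift m f) ⟩
  ∑[ j < suc m ] f j + f (suc m)           ∎
  where open ≡-Reasoning

∑-vanishing-tail : ∀ {m} m′ {f : ℕ → ℕ} → (∀ j → m ≤ j → j < m′ → f j ≡ 0) → m ≤ m′ →
                   ∑< m′ f ≡ ∑< m f
∑-vanishing-tail zero      _   z≤n = refl
∑-vanishing-tail {m} (suc m′) {f} f≡0 m≤1+m′ with m≤n⇒m<n∨m≡n m≤1+m′
... | inj₂ refl       = refl
... | inj₁ (s≤s m≤m′) = begin
  ∑< m′ f + f m′ ≡⟨ cong₂ _+_ (∑-vanishing-tail m′ (λ j m≤j j<m′ → f≡0 j m≤j (m≤n⇒m≤1+n j<m′))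
                                                  m≤m′)
                              (f≡0 m′ m≤m′ ≤-refl) ⟩
  ∑< m f + 0     ≡⟨ +-identityʳ _ ⟩
  ∑< m f         ∎
  where open ≡-Reasoning

∑ℤ< : ℕ → (ℕ → ℤ) → ℤ
∑ℤ< zero    f = + 0
∑ℤ< (suc m) f = ∑ℤ< m f +ℤ f m

syntax ∑ℤ< m (λ j → e) = ∑ℤ[ j < m ] e

∑ℤ-cong : ∀ m {f g : ℕ → ℤ} → (∀ j → j < m → f j ≡ g j) → ∑ℤ< m f ≡ ∑ℤ< m g
∑ℤ-cong zero    _  = refl
∑ℤ-cong (suc m) eq = cong₂ _+ℤ_ (∑ℤ-cong m (λ j j<m → eq j (m≤n⇒m≤1+n j<m))) (eq m ≤-refl)

∑ℤ-+ : ∀ m (f g : ℕ → ℤ) → ∑ℤ[ j < m ] (f j +ℤ g j) ≡ ∑ℤ< m f +ℤ ∑ℤ< m g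
∑ℤ-+ zero    f g = refl
∑ℤ-+ (suc m) f g =
  trans (cong (_+ℤ (f m +ℤ g m)) (∑ℤ-+ m f g)) (interchange (∑ℤ< m f) (∑ℤ< m g) (f m) (g m))
  where open import Algebra.Properties.CommutativeSemigroup ℤ.+-commutativeSemigroup using (interchange)

∑ℤ-* : ∀ m c (f : ℕ → ℤ) → ∑ℤ[ j < m ] (c *ℤ f j) ≡ c *ℤ ∑ℤ< m f
∑ℤ-* zero    c f = sym (ℤ.*-zeroʳ c)
∑ℤ-* (suc m) c f = trans (cong (_+ℤ c *ℤ f m) (∑ℤ-* m c f)) (sym (ℤ.*-distribˡ-+ c (∑ℤ< m f) (f m)))

∑ℤ-zero : ∀ m → ∑ℤ[ j < m ] (+ 0) ≡ + 0
∑ℤ-zero zero    = refl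
∑ℤ-zero (suc m) = trans (ℤ.+-identityʳ _) (∑ℤ-zero m)

+-∑ : ∀ m (f : ℕ → ℕ) → + ∑< m f ≡ ∑ℤ[ j < m ] (+ f j)
+-∑ zero    f = refl
+-∑ (suc m) f = trans (ℤ.pos-+ (∑< m f) (f m)) (cong (_+ℤ + f m) (+-∑ m f))

#132-from : ℕ → List ℕ → ℕ
#132-from t w = count (λ l → is132 (t ∷ l) ≟ᵇ true) (choose 2 w)

#123-from : ℕ → List ℕ → ℕ
#123-from t w = count (λ l → is123 (t ∷ l) ≟ᵇ true) (choose 2 w)

between? : ∀ t y → Decidable (λ c → t < c × c < y)
between? t y c = t <? c ×-dec c <? y

<ᵇ⇔< : ∀ {m n} → (m <ᵇ n) ≡ true ⇔ m < n
<ᵇ⇔< {m} {n} = mk⇔ (<ᵇ⇒< m n ∘ from T-≡) (to T-≡ ∘ <⇒<ᵇ)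

≡ᵇ⇔≡ : ∀ {m n} → (m ≡ᵇ n) ≡ true ⇔ m ≡ n
≡ᵇ⇔≡ {m} {n} = mk⇔ (≡ᵇ⇒≡ m n ∘ from T-≡) (to T-≡ ∘ ≡⇒≡ᵇ m n)

∧⇔× : ∀ {x y} → (x ∧ y) ≡ true ⇔ (x ≡ true × y ≡ true)
∧⇔× {true}  {true}  = mk⇔ (λ _ → refl , refl) (λ _ → refl)
∧⇔× {true}  {false} = mk⇔ (λ ()) (λ ())
∧⇔× {false}         = mk⇔ (λ ()) (λ ())

is132⇔ : ∀ {a b c} → is132 (a ∷ b ∷ c ∷ []) ≡ true ⇔ (a < c × c < b)
is132⇔ = mk⇔ (λ e → let (p , q) = to ∧⇔× e in to <ᵇ⇔< p , to <ᵇ⇔< q)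
             (λ (p , q) → from ∧⇔× (from <ᵇ⇔< p , from <ᵇ⇔< q))

is123⇔ : ∀ {a b c} → is123 (a ∷ b ∷ c ∷ []) ≡ true ⇔ (a < b × b < c)
is123⇔ = mk⇔ (λ e → let (p , q) = to ∧⇔× e in to <ᵇ⇔< p , to <ᵇ⇔< q)
             (λ (p , q) → from ∧⇔× (from <ᵇ⇔< p , from <ᵇ⇔< q))

count-choose-∷ : ∀ {P : List ℕ → Set} (P? : Decidable P) k x w →
  count P? (choose (suc k) (x ∷ w)) ≡ count (λ l → P? (x ∷ l)) (choose k w) + count P? (choose (suc k) w)
count-choose-∷ P? k x w =
  trans (count-++ P? (map (x ∷_) (choose k w)) (choose (suc k) w)) (cong (_+ _) (count-map P? (x ∷_) (choose k w)))

choose-1 : ∀ w → choose 1 w ≡ map [_] w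
choose-1 []      = refl
choose-1 (c ∷ w) = cong ([ c ] ∷_) (choose-1 w)

#132-∷ : ∀ x w → #132 (x ∷ w) ≡ #132-from x w + #132 w
#132-∷ = count-choose-∷ _ 2

#123-∷ : ∀ x w → #123 (x ∷ w) ≡ #123-from x w + #123 w
#123-∷ = count-choose-∷ _ 2

count-pairs-∷ : ∀ {P : List ℕ → Set} (P? : Decidable P) y w →
  count P? (choose 2 (y ∷ w)) ≡ count (λ c → P? (y ∷ c ∷ [])) w + count P? (choose 2 w)
count-pairs-∷ P? y w = trans (count-choose-∷ P? 1 y w)
  (cong (_+ _) (trans (cong (count _) (choose-1 w)) (count-map _ [_] w)))

#132-from-∷ : ∀ t y w → #132-from t (y ∷ w) ≡ count (between? t y) w + #132-from t w
#132-from-∷ t y w = trans (count-pairs-∷ _ y w) (cong (_+ _) (count-cong (All.universal (λ _ → is132⇔) w)))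

#123-from-∷ : ∀ x y w → #123-from x (y ∷ w) ≡ count (λ c → x <? y ×-dec y <? c) w + #123-from x w
#123-from-∷ x y w = trans (count-pairs-∷ _ y w) (cong (_+ _) (count-cong (All.universal (λ _ → is123⇔) w)))

C2-suc : ∀ m → suc m C 2 ≡ m + m C 2
C2-suc m = trans (sym (nCk+nC[k+1]≡[n+1]C[k+1] m 1)) (cong (_+ m C 2) (nC1≡n m))

-- In a word without repeated letters, two letters above x form either a 132 or a 123 with x.
#132-from+#123-from : ∀ x {w} → Unique w → #132-from x w + #123-from x w ≡ count (x <?_) w C 2
#132-from+#123-from x {[]}    _          = refl
#132-from+#123-from x {y ∷ w} (y≢w ∷ uw) = begin
  #132-from x (y ∷ w) + #123-from x (y ∷ w)
    ≡⟨ cong₂ _+_ (#132-from-∷ x y w) (#123-from-∷ x y w) ⟩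
  (count (between? x y) w + #132-from x w) + (count (λ c → x <? y ×-dec y <? c) w + #123-from x w)
    ≡⟨ interchange (count (between? x y) w) (#132-from x w) _ _ ⟩
  (count (between? x y) w + count (λ c → x <? y ×-dec y <? c) w) + (#132-from x w + #123-from x w)
    ≡⟨ cong₂ _+_ (pairs-with-y (x <? y)) (#132-from+#123-from x uw) ⟩
  (if does (x <? y) then count (x <?_) w else 0) + count (x <?_) w C 2
    ≡⟨ add-y (x <? y) ⟩
  count (x <?_) (y ∷ w) C 2 ∎
  where
  open ≡-Reasoning
  open import Algebra.Properties.CommutativeSemigroup Data.Nat.Properties.+-commutativeSemigroup using (interchange)
  pairs-with-y : (x<y? : Dec (x < y)) →
    count (between? x y) w + count (λ c → x<y? ×-dec y <? c) w ≡ (if does x<y? then count (x <?_) w else 0)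
  pairs-with-y (yes x<y) = begin
    count (between? x y) w + count (λ c → yes x<y ×-dec y <? c) w
      ≡⟨ cong (_+_ (count (between? x y) w)) (count-cong (All.map split y≢w)) ⟨
    count (between? x y) w + count (λ c → x <? c ×-dec ¬? (c <? y)) w
      ≡⟨ count-split (x <?_) (_<? y) w ⟨
    count (x <?_) w ∎
    where
    split : ∀ {c} → y ≢ c → (x < c × ¬ c < y) ⇔ (x < y × y < c)
    split y≢c = mk⇔ (λ (_ , c≮y) → x<y , ≤∧≢⇒< (≮⇒≥ c≮y) y≢c)
                    (λ (_ , y<c) → <-trans x<y y<c , <⇒≱ y<c ∘ <⇒≤)
  pairs-with-y (no x≮y) = cong₂ _+_
    (All¬⇒count≡0 _ (All.universal (λ _ (x<c , c<y) → x≮y (<-trans x<c c<y)) w))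
    (count-guard (no x≮y) (y <?_) w)
  add-y : (x<y? : Dec (x < y)) →
    (if does x<y? then count (x <?_) w else 0) + count (x <?_) w C 2 ≡ count (x <?_) (y ∷ w) C 2
  add-y (yes x<y) = trans (sym (C2-suc (count (x <?_) w))) (cong (_C 2) (sym (count-accept (x <?_) w x<y)))
  add-y (no x≮y)  = cong (_C 2) (sym (count-reject (x <?_) w x≮y))

#132-from-mono : ∀ {t x} w → All (λ c → t < c → x < c) w → #132-from t w ≤ #132-from x w
#132-from-mono         []      _         = z≤n
#132-from-mono {t} {x} (y ∷ w) (_ ∷ t<⇒x<) = begin
  #132-from t (y ∷ w)                    ≡⟨ #132-from-∷ t y w ⟩
  count (between? t y) w + #132-from t w ≤⟨ +-mono-≤ (count-mono _ _ (All.map between-mono t<⇒x<))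
                                                      (#132-from-mono w t<⇒x<) ⟩
  count (between? x y) w + #132-from x w ≡⟨ #132-from-∷ x y w ⟨
  #132-from x (y ∷ w)                    ∎
  where
  open ≤-Reasoning
  between-mono : ∀ {c} → (t < c → x < c) → t < c × c < y → x < c × c < y
  between-mono t<c⇒x<c (t<c , c<y) = t<c⇒x<c t<c , c<y

#132-from-above : ∀ {t} w → All (_≤ t) w → #132-from t w ≡ 0
#132-from-above     []      _          = refl
#132-from-above {t} (y ∷ w) (_ ∷ w≤t) = trans (#132-from-∷ t y w)
  (cong₂ _+_ (All¬⇒count≡0 _ (All.map (λ c≤t (t<c , _) → <⇒≱ t<c c≤t) w≤t)) (#132-from-above w w≤t))

-- Free letters and their ranks

alphabet : ℕ → List ℕ
alphabet n = map suc (upTo n)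

free : ℕ → List ℕ → List ℕ
free n U = filter (_∉? U) (alphabet n)

rank : ℕ → List ℕ → ℕ → ℕ
rank n U m = count (m <?_) (free n U)

∈-alphabet⁻ : ∀ {n x} → x ∈ alphabet n → x ≤ n
∈-alphabet⁻ x∈ with ∈-map⁻ suc x∈
... | _ , i∈ , refl = ∈-upTo⁻ i∈

alphabet-suc : ∀ n → alphabet (suc n) ≡ alphabet n ++ [ suc n ]
alphabet-suc n = trans (cong (map suc) (sym (upTo-∷ʳ n))) (map-++ suc (upTo n) [ n ])

free-unique : ∀ n U → Unique (free n U)
free-unique n U = Unique.filter⁺ (_∉? U) (Unique.map⁺ suc-injective (Unique.upTo⁺ n))

words-wellFormed : ∀ n k → All (λ w → length w ≡ k × All (_∈ alphabet n) w) (words n k)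
words-wellFormed n zero    = (refl , []) ∷ []
words-wellFormed n (suc k) = concat⁺ (map⁺ (All.tabulate λ x∈ →
  map⁺ (All.map (λ (|w| , w⊆) → cong suc |w| , x∈ ∷ w⊆) (words-wellFormed n k))))

∉-∷⇔ : ∀ {y x : ℕ} {U} → y ∉ x ∷ U ⇔ (y ≢ x × y ∉ U)
∉-∷⇔ = mk⇔ (λ y∉ → y∉ ∘ here , y∉ ∘ there)
           (λ { (y≢x , _) (here y≡x) → y≢x y≡x ; (_ , y∉U) (there y∈U) → y∉U y∈U })

module _ {n : ℕ} {U : List ℕ} {x : ℕ} (x∈ : x ∈ alphabet n) (x∉U : x ∉ U) where

  count-free-∷ : ∀ {P : ℕ → Set} (P? : Decidable P) →
                 count P? (free n U) ≡ count P? [ x ] + count P? (free n (x ∷ U))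
  count-free-∷ {P} P? = begin
    count P? (free n U)
      ≡⟨ count-split P? (_≟ x) (free n U) ⟩
    count (λ y → P? y ×-dec y ≟ x) (free n U) + count (λ y → P? y ×-dec ¬? (y ≟ x)) (free n U)
      ≡⟨ cong₂ _+_ (at-x (P? x)) (trans (count-filter (_∉? U) (λ y → P? y ×-dec ¬? (y ≟ x)) (alphabet n))
                                  (trans (count-cong (All.universal (λ _ → others) (alphabet n)))
                                         (sym (count-filter (_∉? x ∷ U) P? (alphabet n))))) ⟩
    count P? [ x ] + count P? (free n (x ∷ U)) ∎
    where
    open ≡-Reasoning
    x∈F = ∈-filter⁺ (_∉? U) x∈ x∉U
    at-x : Dec (P x) → count (λ y → P? y ×-dec y ≟ x) (free n U) ≡ count P? [ x ]
    at-x (yes p) =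
      trans (count-cong {Q? = _≟ x} (All.universal (λ _ → mk⇔ proj₂ (λ { refl → p , refl })) (free n U)))
            (trans (unique⇒count≡1 _≟_ (free-unique n U) x∈F) (sym (count-accept P? [] p)))
    at-x (no ¬p) =
      trans (All¬⇒count≡0 (λ y → P? y ×-dec y ≟ x) (All.universal (λ _ → λ { (py , refl) → ¬p py }) (free n U)))
            (sym (count-reject P? [] ¬p))
    others : ∀ {y} → (y ∉ U × (P y × y ≢ x)) ⇔ (y ∉ x ∷ U × P y)
    others = mk⇔ (λ (y∉U , py , y≢x) → from ∉-∷⇔ (y≢x , y∉U) , py)
                 (λ (y∉ , py) → let (y≢x , y∉U) = to ∉-∷⇔ y∉ in y∉U , py , y≢x)

  count-free-∷-reject : ∀ {P : ℕ → Set} (P? : Decidable P) → ¬ P x →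
                        count P? (free n U) ≡ count P? (free n (x ∷ U))
  count-free-∷-reject P? ¬px = trans (count-free-∷ P?) (cong (_+ count P? (free n (x ∷ U))) (count-reject P? [] ¬px))

  length-free-∷ : length (free n U) ≡ suc (length (free n (x ∷ U)))
  length-free-∷ =
    trans (sym (count-yes (free n U))) (trans (count-free-∷ (λ _ → yes tt)) (cong suc (count-yes (free n (x ∷ U)))))
    where count-yes : ∀ xs → count (λ _ → yes tt) xs ≡ length xs
          count-yes xs = cong length (filter-all _ (All.universal (λ _ → tt) xs))

  rank-∷-self : rank n (x ∷ U) x ≡ rank n U x
  rank-∷-self = sym (count-free-∷-reject (x <?_) (<-irrefl refl))

  free-∷-≢ : All (_≢ x) (free n (x ∷ U))
  free-∷-≢ = All.tabulate λ y∈ →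
    proj₁ (to ∉-∷⇔ (proj₂ (∈-filter⁻ (_∉? x ∷ U) {xs = alphabet n} y∈)))

  rank-split : ∀ {t} → t < x → rank n U t ≡ count (between? t x) (free n U) + suc (rank n U x)
  rank-split {t} t<x = begin
    count (t <?_) (free n U)
      ≡⟨ count-split (t <?_) (_<? x) (free n U) ⟩
    count (between? t x) (free n U) + count at-least-x? (free n U)
      ≡⟨ cong (_+_ (count (between? t x) (free n U))) (count-free-∷ at-least-x?) ⟩
    count (between? t x) (free n U) + (count at-least-x? [ x ] + count at-least-x? (free n (x ∷ U)))
      ≡⟨ cong (λ c → count (between? t x) (free n U) + c)
              (cong₂ _+_ (count-accept at-least-x? [] (t<x , <-irrefl refl))
                         (count-cong {Q? = x <?_} (All.map above-x free-∷-≢))) ⟩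
    count (between? t x) (free n U) + suc (rank n (x ∷ U) x)
      ≡⟨ cong (λ ρ → count (between? t x) (free n U) + suc ρ) rank-∷-self ⟩
    count (between? t x) (free n U) + suc (rank n U x) ∎
    where
    open ≡-Reasoning
    at-least-x? = λ y → t <? y ×-dec ¬? (y <? x)
    above-x : ∀ {y} → y ≢ x → (t < y × ¬ y < x) ⇔ x < y
    above-x y≢x = mk⇔ (λ (_ , y≮x) → ≤∧≢⇒< (≮⇒≥ y≮x) (y≢x ∘ sym))
                      (λ x<y → <-trans t<x x<y , <⇒≱ x<y ∘ <⇒≤)

  between≡0⇔ : ∀ {t} → count (between? t x) (free n U) ≡ 0 ⇔ rank n U t ≤ suc (rank n U x)
  between≡0⇔ {t} with t <? x
  ... | yes t<x = mk⇔
    (λ b≡0 → ≤-reflexive (trans (rank-split t<x) (cong (_+ _) b≡0)))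
    (λ t≤ → n≤0⇒n≡0 (+-cancelʳ-≤ (suc (rank n U x)) _ 0 (subst (_≤ _) (rank-split t<x) t≤)))
  ... | no t≮x  = mk⇔
    (λ _ → m≤n⇒m≤1+n (rank-antitone (≮⇒≥ t≮x)))
    (λ _ → All¬⇒count≡0 (between? t x) (All.universal (λ _ (t<c , c<x) → t≮x (<-trans t<c c<x)) (free n U)))
    where
    rank-antitone : ∀ {m m′} → m ≤ m′ → rank n U m′ ≤ rank n U m
    rank-antitone {m} {m′} m≤m′ =
      count-mono (m′ <?_) (m <?_) (All.universal (λ _ → ≤-<-trans m≤m′) (free n U))

rank-top : ∀ n U → rank n U n ≡ 0
rank-top n U = All¬⇒count≡0 (n <?_) (All.tabulate λ y∈ n<y →
  <⇒≱ n<y (∈-alphabet⁻ (proj₁ (∈-filter⁻ (_∉? U) {xs = alphabet n} y∈))))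

free-suc : ∀ n U → free (suc n) U ≡ free n U ++ filter (_∉? U) [ suc n ]
free-suc n U = trans (cong (filter (_∉? U)) (alphabet-suc n)) (filter-++ (_∉? U) (alphabet n) [ suc n ])

rank-suc : ∀ n U {x} → x ≤ n → rank (suc n) U x ≡ rank n U x + count (_∉? U) [ suc n ]
rank-suc n U {x} x≤n = begin
  count (x <?_) (free (suc n) U)
    ≡⟨ cong (count (x <?_)) (free-suc n U) ⟩
  count (x <?_) (free n U ++ filter (_∉? U) [ suc n ])
    ≡⟨ count-++ (x <?_) (free n U) _ ⟩
  rank n U x + count (x <?_) (filter (_∉? U) [ suc n ])
    ≡⟨ cong (_+_ (rank n U x)) (trans (count-filter (_∉? U) (x <?_) [ suc n ])
                                      (count-cong {P? = λ y → y ∉? U ×-dec x <? y} {Q? = _∉? U}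
                                                  (mk⇔ proj₁ (_, s≤s x≤n) ∷ []))) ⟩
  rank n U x + count (_∉? U) [ suc n ] ∎
  where open ≡-Reasoning

-- The free letters have the ranks 0, 1, …, length (free n U) ∸ 1, each exactly once.
reindex : ∀ n U (G : ℕ → ℕ) →
  sum (map (λ x → if does (x ∉? U) then G (rank n U x) else 0) (alphabet n)) ≡ ∑< (length (free n U)) G
reindex zero    U G = refl
reindex (suc n) U G = begin
  sum (map F (alphabet (suc n)))
    ≡⟨ cong (λ xs → sum (map F xs)) (alphabet-suc n) ⟩
  sum (map F (alphabet n ++ [ suc n ]))
    ≡⟨ trans (cong sum (map-++ F (alphabet n) [ suc n ])) (sum-++ (map F (alphabet n)) [ F (suc n) ]) ⟩
  sum (map F (alphabet n)) + (F (suc n) + 0)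
    ≡⟨ cong₂ _+_ (trans (cong sum (map-cong-local (All.tabulate lower-letter))) (reindex n U (λ j → G (j + c))))
                 (+-identityʳ (F (suc n))) ⟩
  ∑[ j < L ] G (j + c) + F (suc n)
    ≡⟨ add-top (suc n ∉? U) ⟩
  ∑< (L + c) G
    ≡⟨ cong (λ m → ∑< m G) (trans (cong length (free-suc n U)) (length-++ (free n U))) ⟨
  ∑< (length (free (suc n) U)) G ∎
  where
  open ≡-Reasoning
  F : ℕ → ℕ
  F x = if does (x ∉? U) then G (rank (suc n) U x) else 0
  c = count (_∉? U) [ suc n ]
  L = length (free n U)
  lower-letter : ∀ {x} → x ∈ alphabet n → F x ≡ (if does (x ∉? U) then G (rank n U x + c) else 0)
  lower-letter {x} x∈ = cong (λ ρ → if does (x ∉? U) then G ρ else 0) (rank-suc n U (∈-alphabet⁻ x∈))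
  top-letter : F (suc n) ≡ (if does (suc n ∉? U) then G 0 else 0)
  top-letter = cong (λ ρ → if does (suc n ∉? U) then G ρ else 0) (rank-top (suc n) U)
  add-top : Dec (suc n ∉ U) → ∑[ j < L ] G (j + c) + F (suc n) ≡ ∑< (L + c) G
  add-top (yes p) = begin
    ∑[ j < L ] G (j + c) + F (suc n)
      ≡⟨ cong₂ (λ c′ v → ∑[ j < L ] G (j + c′) + v) c≡1
               (trans top-letter (cong (if_then G 0 else 0) (dec-true (suc n ∉? U) p))) ⟩
    ∑[ j < L ] G (j + 1) + G 0
      ≡⟨ cong (_+ G 0) (∑-cong L (λ j _ → cong G (+-comm j 1))) ⟩
    ∑[ j < L ] G (suc j) + G 0
      ≡⟨ ∑-shift L G ⟩
    ∑< (suc L) G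
      ≡⟨ cong (λ m → ∑< m G) (trans (+-comm 1 L) (cong (_+_ L) (sym c≡1))) ⟩
    ∑< (L + c) G ∎
    where c≡1 = count-accept (_∉? U) [] p
  add-top (no ¬p) = begin
    ∑[ j < L ] G (j + c) + F (suc n)
      ≡⟨ cong₂ (λ c′ v → ∑[ j < L ] G (j + c′) + v) c≡0
               (trans top-letter (cong (if_then G 0 else 0) (dec-false (suc n ∉? U) ¬p))) ⟩
    ∑[ j < L ] G (j + 0) + 0
      ≡⟨ trans (+-identityʳ _) (∑-cong L (λ j _ → cong G (+-identityʳ j))) ⟩
    ∑< L G
      ≡⟨ cong (λ m → ∑< m G) (trans (sym (+-identityʳ L)) (cong (_+_ L) (sym c≡0))) ⟩
    ∑< (L + c) G ∎
    where c≡0 = count-reject (_∉? U) [] ¬p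

-- Admissible words and their recursive count

-- The condition #132-from t w ≡ 0 says that the letters of w above t appear in increasing order.
Admissible : List ℕ → ℕ → ℕ → List ℕ → Set
Admissible U t r w = Unique w × All (_∉ U) w × #132 w ≡ 0 × #132-from t w ≡ 0 × #123 w ≡ r

admissible? : ∀ U t r → Decidable (Admissible U t r)
admissible? U t r w =
  unique? w ×-dec All.all? (_∉? U) w ×-dec #132 w ≟ 0 ×-dec #132-from t w ≟ 0 ×-dec #123 w ≟ r

-- N k h r counts the 132-avoiding permutations of k letters with r occurrences of 123 whose h largest letters
-- appear in increasing order.  A first letter followed by j larger letters completes j C 2 occurrences of 123
-- (those letters must increase), and it keeps the h largest letters increasing iff h ≤ j + 1.
allowed : ℕ → ℕ → ℕ → Bool
allowed h r j = (h ≤ᵇ suc j) ∧ (j C 2 ≤ᵇ r)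

N : ℕ → ℕ → ℕ → ℕ
N zero    h r = if (h ≡ᵇ 0) ∧ (r ≡ᵇ 0) then 1 else 0
N (suc k) h r = ∑[ j < suc k ] (if allowed h r j then N k j (r ∸ j C 2) else 0)

module FirstLetter {n : ℕ} {U : List ℕ} {x : ℕ} (x∈ : x ∈ alphabet n) where

  ρ : ℕ
  ρ = rank n U x

  CanLead : ℕ → ℕ → Set
  CanLead t r = x ∉ U × rank n U t ≤ suc ρ × ρ C 2 ≤ r

  canLead? : ∀ t r → Dec (CanLead t r)
  canLead? t r = x ∉? U ×-dec rank n U t ≤? suc ρ ×-dec ρ C 2 ≤? r

  module _ {w : List ℕ} (w⊆ : All (_∈ alphabet n) w) (|free| : length (free n U) ≡ suc (length w)) where

    module _ (x∉U : x ∉ U) (uw : Unique w) (w∉ : All (_∉ x ∷ U) w) where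

      counts-on-w : ∀ {P : ℕ → Set} (P? : Decidable P) → count P? w ≡ count P? (free n (x ∷ U))
      counts-on-w = count-enumeration _≟_ uw (free-unique n (x ∷ U))
        (All.zipWith (λ (y∈ , y∉) → ∈-filter⁺ (_∉? x ∷ U) y∈ y∉) (w⊆ , w∉))
        (suc-injective (trans (sym |free|) (length-free-∷ x∈ x∉U)))

      between-on-w : ∀ t → count (between? t x) w ≡ count (between? t x) (free n U)
      between-on-w t = trans (counts-on-w (between? t x))
        (sym (count-free-∷-reject x∈ x∉U (between? t x) (λ (_ , x<x) → <-irrefl refl x<x)))

      #123-from-on-w : #132-from x w ≡ 0 → #123-from x w ≡ ρ C 2
      #123-from-on-w no-132 = begin
        #123-from x w                     ≡⟨ cong (_+ #123-from x w) no-132 ⟨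
        #132-from x w + #123-from x w     ≡⟨ #132-from+#123-from x uw ⟩
        count (x <?_) w C 2               ≡⟨ cong (_C 2) (trans (counts-on-w (x <?_)) (rank-∷-self x∈ x∉U)) ⟩
        ρ C 2                             ∎
        where open ≡-Reasoning

    admissible-∷⇒ : ∀ {t r} → Admissible U t r (x ∷ w) → CanLead t r × Admissible (x ∷ U) x (r ∸ ρ C 2) w
    admissible-∷⇒ {t} {r} (x≢w ∷ uw , x∉U ∷ w∉U , no-132 , increasing , has-r) =
      (x∉U , rank-ok , ρC2≤r) , (uw , w∉ , m+n≡0⇒n≡0 (#132-from x w) split-132 , from-x≡0 , has-r∸ρC2)
      where
      w∉ : All (_∉ x ∷ U) w
      w∉ = All.zipWith (λ (x≢y , y∉U) → from ∉-∷⇔ (x≢y ∘ sym , y∉U)) (x≢w , w∉U)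
      split-132 : #132-from x w + #132 w ≡ 0
      split-132 = trans (sym (#132-∷ x w)) no-132
      from-x≡0 = m+n≡0⇒m≡0 (#132-from x w) split-132
      split-increasing : count (between? t x) w + #132-from t w ≡ 0
      split-increasing = trans (sym (#132-from-∷ t x w)) increasing
      rank-ok = to (between≡0⇔ x∈ x∉U)
                   (trans (sym (between-on-w x∉U uw w∉ t)) (m+n≡0⇒m≡0 _ split-increasing))
      split-123 : ρ C 2 + #123 w ≡ r
      split-123 = trans (cong (_+ #123 w) (sym (#123-from-on-w x∉U uw w∉ from-x≡0))) (trans (sym (#123-∷ x w)) has-r)
      ρC2≤r = subst (ρ C 2 ≤_) split-123 (m≤m+n (ρ C 2) (#123 w))
      has-r∸ρC2 = trans (sym (m+n∸m≡n (ρ C 2) (#123 w))) (cong (_∸ ρ C 2) split-123)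

    admissible-∷⇐ : ∀ {t r} → CanLead t r × Admissible (x ∷ U) x (r ∸ ρ C 2) w → Admissible U t r (x ∷ w)
    admissible-∷⇐ {t} {r} ((x∉U , rank-ok , ρC2≤r) , (uw , w∉ , no-132 , from-x≡0 , has-r∸ρC2)) =
      (x≢w ∷ uw , x∉U ∷ All.map (proj₂ ∘ to ∉-∷⇔) w∉ , trans (#132-∷ x w) (cong₂ _+_ from-x≡0 no-132) ,
       increasing , has-r)
      where
      x≢w : All (x ≢_) w
      x≢w = All.map (λ y∉ x≡y → proj₁ (to ∉-∷⇔ y∉) (sym x≡y)) w∉
      no-between : count (between? t x) w ≡ 0
      no-between = trans (between-on-w x∉U uw w∉ t) (from (between≡0⇔ x∈ x∉U) rank-ok)
      t<⇒x< : All (λ c → t < c → x < c) w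
      t<⇒x< = All.zipWith (λ (¬t<c<x , x≢c) t<c → ≤∧≢⇒< (≮⇒≥ (λ c<x → ¬t<c<x (t<c , c<x))) x≢c)
                          (count≡0⇒All¬ (between? t x) no-between , x≢w)
      increasing = trans (#132-from-∷ t x w)
        (cong₂ _+_ no-between (n≤0⇒n≡0 (subst (#132-from t w ≤_) from-x≡0 (#132-from-mono w t<⇒x<))))
      has-r = trans (#123-∷ x w)
        (trans (cong₂ _+_ (#123-from-on-w x∉U uw w∉ from-x≡0) has-r∸ρC2) (m+[n∸m]≡n ρC2≤r))

  count-first-letter : ∀ {k} t r → length (free n U) ≡ suc k →
    count (admissible? U t r) (map (x ∷_) (words n k))
      ≡ (if does (canLead? t r) then count (admissible? (x ∷ U) x (r ∸ ρ C 2)) (words n k) else 0)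
  count-first-letter {k} t r |free| = begin
    count (admissible? U t r) (map (x ∷_) (words n k))
      ≡⟨ count-map (admissible? U t r) (x ∷_) (words n k) ⟩
    count (λ w → admissible? U t r (x ∷ w)) (words n k)
      ≡⟨ count-cong (All.map (λ (|w| , w⊆) → let |free|′ = trans |free| (cong suc (sym |w|)) in
                                mk⇔ (admissible-∷⇒ w⊆ |free|′) (admissible-∷⇐ w⊆ |free|′))
                             (words-wellFormed n k)) ⟩
    count (λ w → canLead? t r ×-dec admissible? (x ∷ U) x (r ∸ ρ C 2) w) (words n k)
      ≡⟨ count-guard (canLead? t r) (admissible? (x ∷ U) x (r ∸ ρ C 2)) (words n k) ⟩
    (if does (canLead? t r) then count (admissible? (x ∷ U) x (r ∸ ρ C 2)) (words n k) else 0) ∎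
    where open ≡-Reasoning

count-admissible : ∀ n k U t r → length (free n U) ≡ k → count (admissible? U t r) (words n k) ≡ N k (rank n U t) r
count-admissible n zero U t r |free|≡0 = trans (empty-word r) (cong (λ h → N 0 h r) (sym rank≡0))
  where
  rank≡0 : rank n U t ≡ 0
  rank≡0 = n≤0⇒n≡0 (subst (rank n U t ≤_) |free|≡0 (length-filter (t <?_) (free n U)))
  empty-word : ∀ r → count (admissible? U t r) (words n 0) ≡ N 0 0 r
  empty-word zero    = refl
  empty-word (suc r) = refl
count-admissible n (suc k) U t r |free| = begin
  count (admissible? U t r) (words n (suc k))
    ≡⟨ count-concatMap (admissible? U t r) (λ x → map (x ∷_) (words n k)) (alphabet n) ⟩
  sum (map (λ x → count (admissible? U t r) (map (x ∷_) (words n k))) (alphabet n))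
    ≡⟨ cong sum (map-cong-local (All.tabulate first-letter)) ⟩
  sum (map (λ x → if does (x ∉? U) then G (rank n U x) else 0) (alphabet n))
    ≡⟨ reindex n U G ⟩
  ∑< (length (free n U)) G
    ≡⟨ cong (λ m → ∑< m G) |free| ⟩
  N (suc k) (rank n U t) r ∎
  where
  open ≡-Reasoning
  G : ℕ → ℕ
  G j = if allowed (rank n U t) r j then N k j (r ∸ j C 2) else 0
  first-letter : ∀ {x} → x ∈ alphabet n →
    count (admissible? U t r) (map (x ∷_) (words n k)) ≡ (if does (x ∉? U) then G (rank n U x) else 0)
  first-letter {x} x∈ = trans (count-first-letter t r |free|) (by-freeness (x ∉? U))
    where
    open FirstLetter x∈
    by-freeness : (x∉U? : Dec (x ∉ U)) →
      (if does (x∉U? ×-dec rank n U t ≤? suc ρ ×-dec ρ C 2 ≤? r)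
         then count (admissible? (x ∷ U) x (r ∸ ρ C 2)) (words n k) else 0)
      ≡ (if does x∉U? then G ρ else 0)
    by-freeness (yes x∉U) = cong (if allowed (rank n U t) r ρ then_else 0)
      (trans (count-admissible n k (x ∷ U) x (r ∸ ρ C 2)
                               (suc-injective (trans (sym (length-free-∷ x∈ x∉U)) |free|)))
             (cong (λ h → N k h (r ∸ ρ C 2)) (rank-∷-self x∈ x∉U)))
    by-freeness (no _)    = refl

not-any⇔All≢ : ∀ x ys → not (any (x ≡ᵇ_) ys) ≡ true ⇔ All (x ≢_) ys
not-any⇔All≢ x []       = mk⇔ (λ _ → []) (λ _ → refl)
not-any⇔All≢ x (y ∷ ys) with x ≡ᵇ y in x≡ᵇy
... | true  = mk⇔ (λ ()) (λ { (x≢y ∷ _) → contradiction (≡ᵇ⇒≡ x y (from T-≡ x≡ᵇy)) x≢y })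
... | false = mk⇔ (λ e → x≢y ∷ to (not-any⇔All≢ x ys) e)
                  (λ { (_ ∷ x≢ys) → from (not-any⇔All≢ x ys) x≢ys })
  where
  x≢y : x ≢ y
  x≢y x≡y = subst T x≡ᵇy (≡⇒≡ᵇ x y x≡y)

distinct⇔Unique : ∀ w → distinct w ≡ true ⇔ Unique w
distinct⇔Unique []      = mk⇔ (λ _ → []) (λ _ → refl)
distinct⇔Unique (x ∷ w) = mk⇔
  (λ e → let (x≢w , d) = to ∧⇔× e in to (not-any⇔All≢ x w) x≢w ∷ to (distinct⇔Unique w) d)
  (λ { (x≢w ∷ u) → from ∧⇔× (from (not-any⇔All≢ x w) x≢w , from (distinct⇔Unique w) u) })

a≡N : ∀ n → a n ≡ N n 0 5
a≡N n = begin
  a n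
    ≡⟨ count-filter (λ w → distinct w ≟ᵇ true) (λ π → ((#132 π ≡ᵇ 0) ∧ (#123 π ≡ᵇ 5)) ≟ᵇ true) (words n n) ⟩
  count (λ w → (distinct w ≟ᵇ true) ×-dec (((#132 w ≡ᵇ 0) ∧ (#123 w ≡ᵇ 5)) ≟ᵇ true)) (words n n)
    ≡⟨ count-cong (All.map (λ (_ , w⊆) → admissible⇔ w⊆) (words-wellFormed n n)) ⟩
  count (admissible? [] n 5) (words n n)
    ≡⟨ count-admissible n n [] n 5 |free| ⟩
  N n (rank n [] n) 5
    ≡⟨ cong (λ h → N n h 5) (rank-top n []) ⟩
  N n 0 5 ∎
  where
  open ≡-Reasoning
  |free| : length (free n []) ≡ n
  |free| = trans (cong length (filter-all (_∉? []) (All.universal (λ _ ()) (alphabet n))))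
                 (trans (length-map suc (upTo n)) (length-upTo n))
  admissible⇔ : ∀ {w} → All (_∈ alphabet n) w →
    (distinct w ≡ true × ((#132 w ≡ᵇ 0) ∧ (#123 w ≡ᵇ 5)) ≡ true) ⇔ Admissible [] n 5 w
  admissible⇔ {w} w⊆ = mk⇔
    (λ (d , e) → let (no-132 , has-5) = to ∧⇔× e in
       to (distinct⇔Unique w) d , All.universal (λ _ ()) w , to ≡ᵇ⇔≡ no-132 ,
       #132-from-above w (All.map ∈-alphabet⁻ w⊆) , to ≡ᵇ⇔≡ has-5)
    (λ (u , _ , no-132 , _ , has-5) →
       from (distinct⇔Unique w) u , from ∧⇔× (from ≡ᵇ⇔≡ no-132 , from ≡ᵇ⇔≡ has-5))

-- The transfer operator and the generating function

-- For r ≤ 5 only j < 4 contributes to the recursion of N, since 4 C 2 = 6.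
Step : (ℕ → ℕ → ℤ) → ℕ → ℕ → ℤ
Step f h r = ∑ℤ[ j < 4 ] (if allowed h r j then f j (r ∸ j C 2) else + 0)

Step-+ : ∀ f g h r → Step (λ j s → f j s +ℤ g j s) h r ≡ Step f h r +ℤ Step g h r
Step-+ f g h r =
  trans (∑ℤ-cong 4 {g = λ j → term f j +ℤ term g j} (λ j _ → if-+ (allowed h r j))) (∑ℤ-+ 4 (term f) (term g))
  where
  term = λ (φ : ℕ → ℕ → ℤ) j → if allowed h r j then φ j (r ∸ j C 2) else + 0
  if-+ : ∀ b {x y} → (if b then x +ℤ y else + 0) ≡ (if b then x else + 0) +ℤ (if b then y else + 0)
  if-+ true  = refl
  if-+ false = refl

Step-* : ∀ c f h r → Step (λ j s → c *ℤ f j s) h r ≡ c *ℤ Step f h r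
Step-* c f h r = trans (∑ℤ-cong 4 {g = λ j → c *ℤ term j} (λ j _ → if-* (allowed h r j))) (∑ℤ-* 4 c term)
  where
  term = λ j → if allowed h r j then f j (r ∸ j C 2) else + 0
  if-* : ∀ b {x} → (if b then c *ℤ x else + 0) ≡ c *ℤ (if b then x else + 0)
  if-* true  = refl
  if-* false = sym (ℤ.*-zeroʳ c)

Step-0 : ∀ h r → Step (λ _ _ → + 0) h r ≡ + 0
Step-0 h r = trans (∑ℤ-cong 4 {g = λ _ → + 0} (λ j _ → if-eta (allowed h r j))) (∑ℤ-zero 4)

Step-cong : ∀ {f g : ℕ → ℕ → ℤ} {h r} → (∀ j s → j < 4 → s ≤ r → f j s ≡ g j s) →
            Step f h r ≡ Step g h r
Step-cong {f} {g} {h} {r} eq = ∑ℤ-cong 4 {f = term f} {g = term g} λ j j<4 →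
  cong (if allowed h r j then_else + 0) (eq j (r ∸ j C 2) j<4 (m∸n≤m r (j C 2)))
  where term = λ (φ : ℕ → ℕ → ℤ) j → if allowed h r j then φ j (r ∸ j C 2) else + 0

N-vanishes : ∀ k {j} r → k < j → N k j r ≡ 0
N-vanishes zero    {suc j} r _   = refl
N-vanishes (suc k) {j}     r k<j = ∑-vanishing-tail (suc k) (λ i _ i<1+k → term-vanishes i i<1+k) z≤n
  where
  term-vanishes : ∀ i → i < suc k → (if allowed j r i then N k i (r ∸ i C 2) else 0) ≡ 0
  term-vanishes i i<1+k =
    cong (λ b → if b ∧ (i C 2 ≤ᵇ r) then N k i (r ∸ i C 2) else 0)
         (dec-false (j ≤? suc i) (<⇒≱ (≤-<-trans i<1+k k<j)))

C2≥6 : ∀ {j} → 4 ≤ j → 6 ≤ j C 2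
C2≥6 {j} 4≤j = subst (λ i → 6 ≤ i C 2) (m+[n∸m]≡n 4≤j) (from-4 (j ∸ 4))
  where
  from-4 : ∀ d → 6 ≤ (4 + d) C 2
  from-4 zero    = ≤-refl
  from-4 (suc d) = ≤-trans (from-4 d) (≤-trans (m≤n+m _ (4 + d)) (≤-reflexive (sym (C2-suc (4 + d)))))

N-step : ∀ k h {r} → r ≤ 5 → + N (suc k) h r ≡ Step (λ j s → + N k j s) h r
N-step k h {r} r≤5 = begin
  + ∑[ j < suc k ] term j
    ≡⟨ cong +_ (∑-vanishing-tail (suc k ⊔ 4) beyond-k (m≤m⊔n (suc k) 4)) ⟨
  + ∑[ j < suc k ⊔ 4 ] term j
    ≡⟨ cong +_ (∑-vanishing-tail (suc k ⊔ 4) beyond-3 (m≤n⊔m (suc k) 4)) ⟩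
  + ∑[ j < 4 ] term j
    ≡⟨ +-∑ 4 term ⟩
  ∑ℤ[ j < 4 ] (+ term j)
    ≡⟨ ∑ℤ-cong 4 {g = λ j → if allowed h r j then + N k j (r ∸ j C 2) else + 0}
                 (λ j _ → if-float +_ (allowed h r j)) ⟩
  Step (λ j s → + N k j s) h r ∎
  where
  open ≡-Reasoning
  term : ℕ → ℕ
  term j = if allowed h r j then N k j (r ∸ j C 2) else 0
  beyond-k : ∀ j → suc k ≤ j → j < suc k ⊔ 4 → term j ≡ 0
  beyond-k j k<j _ = trans (cong (if allowed h r j then_else 0) (N-vanishes k (r ∸ j C 2) k<j))
                           (if-eta (allowed h r j))
  beyond-3 : ∀ j → 4 ≤ j → j < suc k ⊔ 4 → term j ≡ 0
  beyond-3 j 4≤j _ = cong (λ b → if b then N k j (r ∸ j C 2) else 0)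
    (trans (cong ((h ≤ᵇ suc j) ∧_) (dec-false (j C 2 ≤? r) (λ j₂≤r → <⇒≱ (s≤s r≤5) (≤-trans (C2≥6 4≤j) j₂≤r))))
           (∧-zeroʳ (h ≤ᵇ suc j)))

module _ (L : (ℕ → ℕ → ℤ) → ℕ → ℕ → ℤ)
         (L-+ : ∀ f g h r → L (λ j s → f j s +ℤ g j s) h r ≡ L f h r +ℤ L g h r)
         (L-* : ∀ c f h r → L (λ j s → c *ℤ f j s) h r ≡ c *ℤ L f h r)
         (L-0 : ∀ h r → L (λ _ _ → + 0) h r ≡ + 0) where

  mulCoeff-linear : ∀ p n (F : ℕ → ℕ → ℕ → ℤ) h r →
    mulCoeff p (λ k → L (F k) h r) n ≡ L (λ j s → mulCoeff p (λ k → F k j s) n) h r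
  mulCoeff-linear []      n       F h r = sym (L-0 h r)
  mulCoeff-linear (c ∷ p) zero    F h r = sym (L-* c (F 0) h r)
  mulCoeff-linear (c ∷ p) (suc n) F h r = begin
    c *ℤ L (F (suc n)) h r +ℤ mulCoeff p (λ k → L (F k) h r) n
      ≡⟨ cong₂ _+ℤ_ (L-* c (F (suc n)) h r) (sym (mulCoeff-linear p n F h r)) ⟨
    L (λ j s → c *ℤ F (suc n) j s) h r +ℤ L (λ j s → mulCoeff p (λ k → F k j s) n) h r
      ≡⟨ L-+ _ _ h r ⟨
    L (λ j s → c *ℤ F (suc n) j s +ℤ mulCoeff p (λ k → F k j s) n) h r ∎
    where open ≡-Reasoning

mulCoeff-cong : ∀ p n {F G : ℕ → ℤ} → (∀ k → k ≤ n → F k ≡ G k) → mulCoeff p F n ≡ mulCoeff p G n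
mulCoeff-cong []      n       eq = refl
mulCoeff-cong (c ∷ p) zero    eq = cong (c *ℤ_) (eq 0 z≤n)
mulCoeff-cong (c ∷ p) (suc n) eq =
  cong₂ _+ℤ_ (cong (c *ℤ_) (eq (suc n) ≤-refl)) (mulCoeff-cong p n (λ k k≤n → eq k (m≤n⇒m≤1+n k≤n)))

mulCoeff-shift : ∀ p n (F : ℕ → ℤ) → length p ≤ suc n →
                 mulCoeff p F (suc n) ≡ mulCoeff p (λ k → F (suc k)) n
mulCoeff-shift []          n       F _         = refl
mulCoeff-shift (c ∷ [])    zero    F _         = ℤ.+-identityʳ _
mulCoeff-shift (c ∷ p)     (suc n) F (s≤s |p|) = cong (c *ℤ F (suc (suc n)) +ℤ_) (mulCoeff-shift p n F |p|)

nth : {A : Set} → A → List A → ℕ → A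
nth d []       _       = d
nth d (x ∷ _)  zero    = x
nth d (_ ∷ xs) (suc i) = nth d xs i

nth-applyUpTo : ∀ {A : Set} (d : A) f {m i} → i < m → nth d (applyUpTo f m) i ≡ f i
nth-applyUpTo d f {suc m} {zero}  _         = refl
nth-applyUpTo d f {suc m} {suc i} (s≤s i<m) = nth-applyUpTo d (f ∘ suc) i<m

Table : Set
Table = List (List ℤ)

tabulate : (ℕ → ℕ → ℤ) → Table
tabulate f = applyUpTo (λ h → applyUpTo (f h) 6) 4

entry : Table → ℕ → ℕ → ℤ
entry T h r = nth (+ 0) (nth [] T h) r

entry-tabulate : ∀ f {h r} → h < 4 → r < 6 → entry (tabulate f) h r ≡ f h r
entry-tabulate f {h} {r} h<4 r<6 =
  trans (cong (λ row → nth (+ 0) row r) (nth-applyUpTo [] (λ h → applyUpTo (f h) 6) h<4))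
        (nth-applyUpTo (+ 0) (f h) r<6)

-- Storing each iterate as data lets Agda's evaluator share it; iterating Step on functions recomputes
-- every value exponentially often.
table : ℕ → Table
table zero    = tabulate (λ h r → + N 0 h r)
table (suc k) = tabulate (Step (entry (table k)))

N-table : ∀ k {h r} → h < 4 → r < 6 → + N k h r ≡ entry (table k) h r
N-table zero            h<4 r<6 = sym (entry-tabulate (λ h r → + N 0 h r) h<4 r<6)
N-table (suc k) {h} {r} h<4 r<6 = begin
  + N (suc k) h r                ≡⟨ N-step k h (≤-pred r<6) ⟩
  Step (λ j s → + N k j s) h r   ≡⟨ Step-cong {h = h} {r} (λ j s j<4 s≤r → N-table k j<4 (≤-<-trans s≤r r<6))
                                  ⟩
  Step (entry (table k)) h r     ≡⟨ entry-tabulate (Step (entry (table k))) h<4 r<6 ⟨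
  entry (table (suc k)) h r      ∎
  where open ≡-Reasoning

denom·N : ℕ → ℕ → ℕ → ℤ
denom·N n h r = mulCoeff denom (λ k → + N k h r) n

denom·N-suc : ∀ n h {r} → 6 ≤ n → r ≤ 5 → denom·N (suc n) h r ≡ Step (denom·N n) h r
denom·N-suc n h {r} 6≤n r≤5 = begin
  mulCoeff denom (λ k → + N k h r) (suc n)
    ≡⟨ mulCoeff-shift denom n (λ k → + N k h r) (s≤s 6≤n) ⟩
  mulCoeff denom (λ k → + N (suc k) h r) n
    ≡⟨ mulCoeff-cong denom n (λ k _ → N-step k h r≤5) ⟩
  mulCoeff denom (λ k → Step (λ j s → + N k j s) h r) n
    ≡⟨ mulCoeff-linear Step Step-+ Step-* Step-0 denom n (λ k j s → + N k j s) h r ⟩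
  Step (denom·N n) h r ∎
  where open ≡-Reasoning

denom·table-13≡0 :
  tabulate (λ h r → mulCoeff denom (λ k → entry (table k) h r) 13) ≡ tabulate (λ _ _ → + 0)
denom·table-13≡0 = refl

denom·N-vanishes : ∀ n {h r} → 13 ≤ n → h < 4 → r < 6 → denom·N n h r ≡ + 0
denom·N-vanishes n {h} {r} 13≤n h<4 r<6 with m≤n⇒m<n∨m≡n 13≤n
... | inj₂ refl = begin
  mulCoeff denom (λ k → + N k h r) 13
    ≡⟨ mulCoeff-cong denom 13 {F = λ k → + N k h r} (λ k _ → N-table k h<4 r<6) ⟩
  mulCoeff denom (λ k → entry (table k) h r) 13
    ≡⟨ entry-tabulate (λ h r → mulCoeff denom (λ k → entry (table k) h r) 13) h<4 r<6 ⟨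
  entry (tabulate (λ h r → mulCoeff denom (λ k → entry (table k) h r) 13)) h r
    ≡⟨ cong (λ T → entry T h r) denom·table-13≡0 ⟩
  entry (tabulate (λ _ _ → + 0)) h r
    ≡⟨ entry-tabulate (λ _ _ → + 0) h<4 r<6 ⟩
  + 0 ∎
  where open ≡-Reasoning
... | inj₁ (s≤s {n = n′} 13≤n′) = begin
  denom·N (suc n′) h r
    ≡⟨ denom·N-suc n′ h (≤-trans (m≤m+n 6 7) 13≤n′) (≤-pred r<6) ⟩
  Step (denom·N n′) h r
    ≡⟨ Step-cong {h = h} {r} (λ j s j<4 s≤r → denom·N-vanishes n′ 13≤n′ j<4 (≤-<-trans s≤r r<6)) ⟩
  Step (λ _ _ → + 0) h r
    ≡⟨ Step-0 h r ⟩
  + 0 ∎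
  where open ≡-Reasoning

numer-vanishes : ∀ {n} → 12 ≤ n → coeff numer n ≡ + 0
numer-vanishes {n} 12≤n = cong (coeff numer) (sym (m+[n∸m]≡n 12≤n))

denom·table≡numer-below-13 :
  applyUpTo (λ n → mulCoeff denom (λ k → entry (table k) 0 5) n) 13 ≡ applyUpTo (coeff numer) 13
denom·table≡numer-below-13 = refl

N-generatingFunction : ∀ n → denom·N n 0 5 ≡ coeff numer n
N-generatingFunction n with n <? 13
... | yes n<13 = begin
  mulCoeff denom (λ k → + N k 0 5) n
    ≡⟨ mulCoeff-cong denom n (λ k _ → N-table k (s≤s z≤n) ≤-refl) ⟩
  mulCoeff denom (λ k → entry (table k) 0 5) n
    ≡⟨ nth-applyUpTo (+ 0) (λ n → mulCoeff denom (λ k → entry (table k) 0 5) n) n<13 ⟨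
  nth (+ 0) (applyUpTo (λ n → mulCoeff denom (λ k → entry (table k) 0 5) n) 13) n
    ≡⟨ cong (λ cs → nth (+ 0) cs n) denom·table≡numer-below-13 ⟩
  nth (+ 0) (applyUpTo (coeff numer) 13) n
    ≡⟨ nth-applyUpTo (+ 0) (coeff numer) n<13 ⟩
  coeff numer n ∎
  where open ≡-Reasoning
... | no n≮13 = trans (denom·N-vanishes n 13≤n (s≤s z≤n) ≤-refl) (sym (numer-vanishes (≤-trans (n≤1+n 12) 13≤n)))
  where
  13≤n : 13 ≤ n
  13≤n = ≮⇒≥ n≮13

mainTheorem6 : (n : ℕ) → mulCoeff denom (λ k → + (a k)) n ≡ coeff numer n
mainTheorem6 n = trans (mulCoeff-cong denom n (λ k _ → cong +_ (a≡N k))) (N-generatingFunction n)
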